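{- Let $G$ be a quasi-spider with partition $(R,C,S)$. Then $G$ is well covered if and only if $R=\emptyset$ and $G$ is a thin spider, possibly with one vertex of $C\cup S$ substituted by a $K_2$.
   Context: A pseudo-split graph is a graph whose vertex set has a partition $(R,C,S)$ such that $C$ induces a clique, $S$ induces an independent set, every vertex of $R$ is adjacent to every vertex of $C$ and non-adjacent to every vertex of $S$, every vertex of $C$ has a neighbor in $S$, and every vertex of $S$ has a non-neighbor in $C$. A spider is a pseudo-split graph with partition $(R,C,S)$ where $C=\{c_1,\dots,c_k\}$, $S=\{s_1,\dots,s_k\}$, $k\geq 2$, and either $s_i$ is adjacent to $c_j$ iff $i=j$ (thin spider) or $s_i$ is adjacent to $c_j$ iff $i\neq j$ (thick spider). A quasi-spider is obtained from a spider with partition $(R,C,S)$ by substituting one vertex of $C\cup S$ by a $K_2$ or by a $\overline{K_2}$ (i.e., replacing it by two adjacent, respectively non-adjacent, vertices each having the same neighbors outside the pair as the replaced vertex); its partition is $(R,C,S)$ with the substituted vertex replaced by the two new vertices in its part. A graph is well covered if all its maximal independent sets have the same size. -}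

module Defs where

open import Data.Nat using (ℕ; _≤_)
open import Data.Fin using (Fin)
open import Data.Fin.Subset using (Subset; _∈_; _⊆_; ∣_∣)
open import Data.Bool using (Bool; true; false)
open import Data.Product using (Σ; ∃; _×_; proj₁)
open import Data.Sum using (_⊎_)
open import Relation.Binary.PropositionalEquality using (_≡_; _≢_)
open import Relation.Nullary using (¬_)
open import Function.Bundles using (_⇔_)
open import Function.Definitions using (Injective)

record Graph (V : Set) : Set where
  field
    adj     : V → V → Bool
    adj-sym : ∀ u v → adj u v ≡ adj v u
    adj-irr : ∀ v → adj v v ≡ false

open Graph public

E : {V : Set} → Graph V → V → V → Set
E G u v = adj G u v ≡ true

induce : {V : Set} → Graph V → (P : V → Set) → Graph (Σ V P)
induce G P = record
  { adj     = λ u v → adj G (proj₁ u) (proj₁ v)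
  ; adj-sym = λ u v → adj-sym G (proj₁ u) (proj₁ v)
  ; adj-irr = λ v → adj-irr G (proj₁ v) }

_－_ : {V : Set} → Graph V → (b : V) → Graph (Σ V (λ v → v ≢ b))
G － b = induce G (λ v → v ≢ b)

data Part : Set where
  R C S : Part

restrict : {V : Set} {b : V} → (V → Part) → Σ V (λ v → v ≢ b) → Part
restrict p v = p (proj₁ v)

record PseudoSplit {V : Set} (G : Graph V) (p : V → Part) : Set where
  field
    C-clique  : ∀ u v → p u ≡ C → p v ≡ C → u ≢ v → E G u v
    S-indep   : ∀ u v → p u ≡ S → p v ≡ S → ¬ E G u v
    R-C-full  : ∀ u v → p u ≡ R → p v ≡ C → E G u v
    R-S-empty : ∀ u v → p u ≡ R → p v ≡ S → ¬ E G u v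
    C-has-S-nbr    : ∀ c → p c ≡ C → ∃ λ s → p s ≡ S × E G c s
    S-has-C-nonnbr : ∀ s → p s ≡ S → ∃ λ c → p c ≡ C × ¬ E G s c

data SpiderType : Set where
  thin thick : SpiderType

Legs : {k : ℕ} → SpiderType → Fin k → Fin k → Set
Legs thin  i j = i ≡ j
Legs thick i j = i ≢ j

record Spider {V : Set} (G : Graph V) (p : V → Part) (t : SpiderType) : Set where
  field
    pseudoSplit : PseudoSplit G p
    k       : ℕ
    2≤k     : 2 ≤ k
    c s     : Fin k → V
    c-inj   : Injective _≡_ _≡_ c
    s-inj   : Injective _≡_ _≡_ s
    c-in-C  : ∀ i → p (c i) ≡ C
    s-in-S  : ∀ i → p (s i) ≡ S
    C-onto  : ∀ v → p v ≡ C → ∃ λ i → c i ≡ v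
    S-onto  : ∀ v → p v ≡ S → ∃ λ i → s i ≡ v
    legs    : ∀ i j → (E G (s i) (c j) ⇔ Legs t i j)

-- G (with partition p) arises from G - b (with the restricted partition) by
-- substituting the vertex a of C ∪ S by the pair {a , b}: a ≠ b lie in the
-- same part (C or S) and have the same neighbours outside {a , b}.
record SubstPair {V : Set} (G : Graph V) (p : V → Part) (a b : V) : Set where
  field
    a≢b     : a ≢ b
    samePart : p a ≡ p b
    notR    : p a ≢ R
    twins   : ∀ v → v ≢ a → v ≢ b → (E G a v ⇔ E G b v)

-- G is a quasi-spider with partition p: obtained from a spider (thin or thick)
-- by substituting a vertex of C ∪ S by K2 (E G a b) or by co-K2 (¬ E G a b).
QuasiSpider : {V : Set} → Graph V → (V → Part) → Set
QuasiSpider {V} G p =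
  Σ SpiderType λ t → Σ V λ a → Σ V λ b →
    SubstPair G p a b × Spider (G － b) (restrict p) t

ThinSpiderK2 : {V : Set} → Graph V → (V → Part) → Set
ThinSpiderK2 {V} G p =
  Σ V λ a → Σ V λ b →
    SubstPair G p a b × E G a b × Spider (G － b) (restrict p) thin

R-empty : {V : Set} → (V → Part) → Set
R-empty p = ∀ v → p v ≢ R

Independent : {n : ℕ} → Graph (Fin n) → Subset n → Set
Independent G I = ∀ u v → u ∈ I → v ∈ I → ¬ E G u v

MaximalIndependent : {n : ℕ} → Graph (Fin n) → Subset n → Set
MaximalIndependent G I =
  Independent G I × (∀ J → Independent G J → I ⊆ J → J ⊆ I)

WellCovered : {n : ℕ} → Graph (Fin n) → Set
WellCovered G = ∀ I J → MaximalIndependent G I → MaximalIndependent G J → ∣ I ∣ ≡ ∣ J ∣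

-- A graph is not well covered as soon as some maximal independent set I admits a 1-for-2
-- exchange: a vertex x ∈ I replaced by two non-adjacent neighbours of x that see nothing else
-- of I. Take I maximal through a clique vertex c other than a; its other members are S-vertices.
-- Such an exchange trades c for r and a leg of c when R ≠ ∅, trades c for a and b when a ∈ S
-- and a, b are non-adjacent, and trades c for two of its legs in a thick spider with
-- k ≥ 3. When a ∈ C and a, b are non-adjacent, the set S of legs is maximal and trades the leg
-- of a for a and b. A thick spider with k = 2 is thin after swapping its two legs. Conversely,
-- in a thin spider without R every maximal independent set is S or S - s j ∪ {c j}, and a vertex
-- b adjacent to its twin a can always be exchanged for a.

module Submission where

open import Defs
open import Data.Nat using (ℕ; suc; _≤_; s≤s; z≤n)
open import Data.Nat.Properties using (≤-trans; ≤-reflexive; 1+n≰n; ≰⇒>; _≤?_; module ≤-Reasoning)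
open import Data.Fin using (Fin; zero; suc; _≟_)
open import Data.Fin.Properties using (any?; all?; 0≢1+n)
open import Data.Fin.Subset using (Subset; _∈_; _∉_; _⊆_; _⊂_; _⊃_; ∣_∣; ⁅_⁆; _∪_; _-_; inside; outside)
open import Data.Fin.Subset.Properties
  using ( _∈?_; x∈⁅x⁆; x∈⁅y⁆⇒x≡y; p⊆p∪q; q⊆p∪q; x∈p∪q⁻; p─q⊆p; x∈p∧x≢y⇒x∈p-y
        ; ⊆-antisym; p⊆q⇒∣p∣≤∣q∣; ∪-identityʳ; p─⊥≡p)
open import Data.Fin.Subset.Induction using (⊃-wellFounded; Acc; acc)
open import Data.Vec using (_∷_; here; there; tabulate)
open import Data.Vec.Properties using (lookup∘tabulate; lookup⇒[]=; []=⇒lookup)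
open import Data.Bool using (true)
import Data.Bool.Properties as Bool
open import Data.Product using (Σ; ∃; ∃₂; _×_; _,_; proj₁; proj₂; map₂)
open import Data.Sum using (_⊎_; inj₁; inj₂; [_,_])
import Data.Sum as Sum
open import Data.Empty using (⊥; ⊥-elim)
open import Function.Bundles using (_⇔_; Equivalence; mk⇔)
open import Function.Properties.Equivalence using () renaming (trans to ⇔-trans)
open import Function using (_∘_; id)
open import Relation.Binary.PropositionalEquality
  using (_≡_; _≢_; refl; sym; trans; cong; subst; module ≡-Reasoning)
open import Relation.Nullary using (¬_; Dec; yes; no; does)
open import Relation.Nullary.Decidable using (_×-dec_; _→-dec_; ¬?; dec-true)

private
  variable
    n m : ℕ

∣p∪⁅x⁆∣≡1+∣p∣ : {p : Subset n} {x : Fin n} → x ∉ p → ∣ p ∪ ⁅ x ⁆ ∣ ≡ suc ∣ p ∣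
∣p∪⁅x⁆∣≡1+∣p∣ {p = inside ∷ p} {zero} x∉p = ⊥-elim (x∉p here)
∣p∪⁅x⁆∣≡1+∣p∣ {p = outside ∷ p} {zero} x∉p = cong suc (cong ∣_∣ (∪-identityʳ p))
∣p∪⁅x⁆∣≡1+∣p∣ {p = inside ∷ p} {suc x} x∉p = cong suc (∣p∪⁅x⁆∣≡1+∣p∣ (x∉p ∘ there))
∣p∪⁅x⁆∣≡1+∣p∣ {p = outside ∷ p} {suc x} x∉p = ∣p∪⁅x⁆∣≡1+∣p∣ (x∉p ∘ there)

∣p∣≡1+∣p-x∣ : {p : Subset n} {x : Fin n} → x ∈ p → ∣ p ∣ ≡ suc ∣ p - x ∣
∣p∣≡1+∣p-x∣ {p = inside ∷ p} here = cong suc (cong ∣_∣ (sym (p─⊥≡p p)))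
∣p∣≡1+∣p-x∣ {p = inside ∷ p} (there x∈p) = cong suc (∣p∣≡1+∣p-x∣ x∈p)
∣p∣≡1+∣p-x∣ {p = outside ∷ p} (there x∈p) = ∣p∣≡1+∣p-x∣ x∈p

x∉p-x : {p : Subset n} {x : Fin n} → x ∉ p - x
x∉p-x {p = _ ∷ p} {zero} ()
x∉p-x {p = _ ∷ p} {suc x} (there x∈p-x) = x∉p-x x∈p-x

x∈p-y⇒x≢y : {p : Subset n} {x y : Fin n} → x ∈ p - y → x ≢ y
x∈p-y⇒x≢y x∈p-y refl = x∉p-x x∈p-y

x∉p⇒p⊂p∪⁅x⁆ : {p : Subset n} {x : Fin n} → x ∉ p → p ⊂ p ∪ ⁅ x ⁆
x∉p⇒p⊂p∪⁅x⁆ {p = p} {x} x∉p = p⊆p∪q ⁅ x ⁆ , x , q⊆p∪q p ⁅ x ⁆ (x∈⁅x⁆ x) , x∉p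

image : (Fin m → Fin n) → Subset n
image f = tabulate λ v → does (any? λ i → f i ≟ v)

∈-image⁺ : (f : Fin m → Fin n) (i : Fin m) → f i ∈ image f
∈-image⁺ f i = lookup⇒[]= (f i) (image f)
  (trans (lookup∘tabulate _ (f i)) (dec-true (any? λ j → f j ≟ f i) (i , refl)))

∈-image⁻ : (f : Fin m → Fin n) {v : Fin n} → v ∈ image f → ∃ λ i → f i ≡ v
∈-image⁻ f {v} v∈f with any? (λ i → f i ≟ v) | trans (sym (lookup∘tabulate _ v)) ([]=⇒lookup v∈f)
... | yes fi≡v | _ = fi≡v
... | no _ | ()

module IndependentSets {n : ℕ} (G : Graph (Fin n)) where

  E-sym : ∀ {u v} → E G u v → E G v u
  E-sym {u} {v} uv = trans (adj-sym G v u) uv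

  E-irrefl : ∀ {v} → ¬ E G v v
  E-irrefl {v} vv with trans (sym vv) (adj-irr G v)
  ... | ()

  E? : ∀ u v → Dec (E G u v)
  E? u v = adj G u v Bool.≟ true

  Dominating : Subset n → Set
  Dominating I = ∀ v → (∀ u → u ∈ I → ¬ E G u v) → v ∈ I

  independent-⊆ : ∀ {I J} → J ⊆ I → Independent G I → Independent G J
  independent-⊆ J⊆I indI u v u∈J v∈J = indI u v (J⊆I u∈J) (J⊆I v∈J)

  ⁅⁆-independent : ∀ w → Independent G ⁅ w ⁆
  ⁅⁆-independent w u v u∈w v∈w
    rewrite x∈⁅y⁆⇒x≡y w u∈w | x∈⁅y⁆⇒x≡y w v∈w = E-irrefl

  ∪⁅⁆-independent : ∀ {I v} → Independent G I → (∀ u → u ∈ I → ¬ E G u v) →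
                    Independent G (I ∪ ⁅ v ⁆)
  ∪⁅⁆-independent {I} {v} indI free x y x∈ y∈ with x∈p∪q⁻ I ⁅ v ⁆ x∈ | x∈p∪q⁻ I ⁅ v ⁆ y∈
  ... | inj₁ x∈I | inj₁ y∈I = indI x y x∈I y∈I
  ... | inj₁ x∈I | inj₂ y∈v rewrite x∈⁅y⁆⇒x≡y v y∈v = free x x∈I
  ... | inj₂ x∈v | inj₁ y∈I rewrite x∈⁅y⁆⇒x≡y v x∈v = free y y∈I ∘ E-sym
  ... | inj₂ x∈v | inj₂ y∈v rewrite x∈⁅y⁆⇒x≡y v x∈v | x∈⁅y⁆⇒x≡y v y∈v = E-irrefl

  maximal⇒dominating : ∀ {I} → MaximalIndependent G I → Dominating I
  maximal⇒dominating {I} (indI , maxI) v free =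
    maxI (I ∪ ⁅ v ⁆) (∪⁅⁆-independent indI free) (p⊆p∪q ⁅ v ⁆) (q⊆p∪q I ⁅ v ⁆ (x∈⁅x⁆ v))

  dominating⇒maximal : ∀ {I} → Independent G I → Dominating I → MaximalIndependent G I
  dominating⇒maximal indI domI =
    indI , λ J indJ I⊆J {v} v∈J → domI v λ u u∈I → indJ u v (I⊆J u∈I) v∈J

  extend : ∀ {T} → Independent G T → ∃ λ I → MaximalIndependent G I × T ⊆ I
  extend = grow (⊃-wellFounded _)
    where
    grow : ∀ {T} → Acc _⊃_ T → Independent G T → ∃ λ I → MaximalIndependent G I × T ⊆ I
    grow {T} (acc larger) indT
      with any? (λ v → ¬? (v ∈? T) ×-dec all? (λ u → u ∈? T →-dec ¬? (E? u v)))
    ... | yes (v , v∉T , free)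
      with grow (larger (x∉p⇒p⊂p∪⁅x⁆ v∉T)) (∪⁅⁆-independent indT free)
    ...   | I , maxI , T∪v⊆I = I , maxI , T∪v⊆I ∘ p⊆p∪q ⁅ v ⁆
    grow {T} _ indT | no noFreeVertex = T , dominating⇒maximal indT domT , id
      where
      domT : Dominating T
      domT v free with v ∈? T
      ... | yes v∈T = v∈T
      ... | no v∉T = ⊥-elim (noFreeVertex (v , v∉T , free))

  independent≤maximal : WellCovered G → ∀ {I J} → MaximalIndependent G I → Independent G J →
                        ∣ J ∣ ≤ ∣ I ∣
  independent≤maximal wc {I} maxI indJ with extend indJ
  ... | J′ , maxJ′ , J⊆J′ = ≤-trans (p⊆q⇒∣p∣≤∣q∣ J⊆J′) (≤-reflexive (wc J′ I maxJ′ maxI))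

  no-1-for-2-exchange : WellCovered G → ∀ {I x y z} → MaximalIndependent G I → x ∈ I →
    E G x y → E G x z → y ≢ z → ¬ E G y z →
    (∀ u → u ∈ I → u ≢ x → ¬ E G u y × ¬ E G u z) → ⊥
  no-1-for-2-exchange wc {I} {x} {y} {z} maxI@(indI , _) x∈I xy xz y≢z ¬yz free =
    1+n≰n (begin
      suc ∣ I ∣                    ≡⟨ cong suc (∣p∣≡1+∣p-x∣ x∈I) ⟩
      suc (suc ∣ K ∣)              ≡⟨ cong suc (∣p∪⁅x⁆∣≡1+∣p∣ y∉K) ⟨
      suc ∣ K ∪ ⁅ y ⁆ ∣            ≡⟨ ∣p∪⁅x⁆∣≡1+∣p∣ z∉K∪y ⟨
      ∣ (K ∪ ⁅ y ⁆) ∪ ⁅ z ⁆ ∣     ≤⟨ independent≤maximal wc maxI indJ ⟩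
      ∣ I ∣                        ∎)
    where
    open ≤-Reasoning
    K = I - x
    K⊆I : K ⊆ I
    K⊆I = p─q⊆p I ⁅ x ⁆
    y∉K : y ∉ K
    y∉K y∈K = indI x y x∈I (K⊆I y∈K) xy
    z∉K∪y : z ∉ K ∪ ⁅ y ⁆
    z∉K∪y z∈ = [ (λ z∈K → indI x z x∈I (K⊆I z∈K) xz) , (λ z∈y → y≢z (sym (x∈⁅y⁆⇒x≡y y z∈y))) ]
               (x∈p∪q⁻ K ⁅ y ⁆ z∈)
    free-y : ∀ u → u ∈ K → ¬ E G u y
    free-y u u∈K = proj₁ (free u (K⊆I u∈K) (x∈p-y⇒x≢y u∈K))
    free-z : ∀ u → u ∈ K ∪ ⁅ y ⁆ → ¬ E G u z
    free-z u u∈ with x∈p∪q⁻ K ⁅ y ⁆ u∈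
    ... | inj₁ u∈K = proj₂ (free u (K⊆I u∈K) (x∈p-y⇒x≢y u∈K))
    ... | inj₂ u∈y rewrite x∈⁅y⁆⇒x≡y y u∈y = ¬yz
    indJ : Independent G ((K ∪ ⁅ y ⁆) ∪ ⁅ z ⁆)
    indJ = ∪⁅⁆-independent (∪⁅⁆-independent (independent-⊆ K⊆I indI) free-y) free-z

  maximal-avoiding-twin : ∀ {a b I} → E G a b → (∀ v → v ≢ a → v ≢ b → E G a v ⇔ E G b v) →
    MaximalIndependent G I → ∃ λ I′ → MaximalIndependent G I′ × ∣ I′ ∣ ≡ ∣ I ∣ × b ∉ I′
  maximal-avoiding-twin {a} {b} {I} ab twins maxI@(indI , _) with b ∈? I
  ... | no b∉I = I , maxI , refl , b∉I
  ... | yes b∈I = I′ , dominating⇒maximal indI′ domI′ , size , b∉I′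
    where
    K = I - b
    I′ = K ∪ ⁅ a ⁆
    K⊆I : K ⊆ I
    K⊆I = p─q⊆p I ⁅ b ⁆
    a∈I′ : a ∈ I′
    a∈I′ = q⊆p∪q K ⁅ a ⁆ (x∈⁅x⁆ a)
    K⊆I′ : ∀ {u} → u ∈ I → u ≢ b → u ∈ I′
    K⊆I′ u∈I u≢b = p⊆p∪q ⁅ a ⁆ (x∈p∧x≢y⇒x∈p-y u∈I u≢b)
    a∉K : a ∉ K
    a∉K a∈K = indI a b (K⊆I a∈K) b∈I ab
    size : ∣ I′ ∣ ≡ ∣ I ∣
    size = trans (∣p∪⁅x⁆∣≡1+∣p∣ a∉K) (sym (∣p∣≡1+∣p-x∣ b∈I))
    b∉I′ : b ∉ I′
    b∉I′ b∈I′ = [ x∉p-x , (λ b∈a → E-irrefl (subst (E G a) (x∈⁅y⁆⇒x≡y a b∈a) ab)) ]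
                (x∈p∪q⁻ K ⁅ a ⁆ b∈I′)
    free-a : ∀ u → u ∈ K → ¬ E G u a
    free-a u u∈K ua =
      indI b u b∈I (K⊆I u∈K)
        (Equivalence.to (twins u (λ { refl → a∉K u∈K }) (x∈p-y⇒x≢y u∈K)) (E-sym ua))
    indI′ : Independent G I′
    indI′ = ∪⁅⁆-independent (independent-⊆ K⊆I indI) free-a
    domI′ : Dominating I′
    domI′ v free with v ≟ a | v ≟ b
    ... | yes refl | _ = a∈I′
    ... | no _ | yes refl = ⊥-elim (free a a∈I′ ab)
    ... | no v≢a | no v≢b = K⊆I′ (maximal⇒dominating maxI v free-I) v≢b
      where
      free-I : ∀ u → u ∈ I → ¬ E G u v
      free-I u u∈I uv with u ≟ b
      ... | yes refl = free a a∈I′ (Equivalence.from (twins v v≢a v≢b) uv)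
      ... | no u≢b = free u (K⊆I′ u∈I u≢b) uv

two-other-indices : 3 ≤ m → (j : Fin m) → ∃₂ λ x y → x ≢ j × y ≢ j × x ≢ y
two-other-indices (s≤s (s≤s (s≤s z≤n))) zero = suc zero , suc (suc zero) , (λ ()) , (λ ()) , (λ ())
two-other-indices (s≤s (s≤s (s≤s z≤n))) (suc zero) = zero , suc (suc zero) , (λ ()) , (λ ()) , (λ ())
two-other-indices (s≤s (s≤s (s≤s z≤n))) (suc (suc j)) = zero , suc zero , (λ ()) , (λ ()) , (λ ())

avoiding : 2 ≤ m → {f : Fin m → Fin n} → (∀ {i j} → f i ≡ f j → i ≡ j) → ∀ a → ∃ λ i → f i ≢ a
avoiding (s≤s (s≤s z≤n)) {f} f-injective a with f zero ≟ a
... | no f0≢a = zero , f0≢a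
... | yes f0≡a = suc zero , λ f1≡a → 0≢1+n (sym (f-injective (trans f1≡a (sym f0≡a))))

swap-of-two : 2 ≤ m → m ≤ 2 →
  ∃ λ (σ : Fin m → Fin m) → (∀ i → σ (σ i) ≡ i) × (∀ i j → σ i ≢ j ⇔ i ≡ j)
swap-of-two (s≤s (s≤s z≤n)) (s≤s (s≤s z≤n)) = σ , σ-involutive , σ-other
  where
  σ : Fin 2 → Fin 2
  σ zero = suc zero
  σ (suc zero) = zero
  σ-involutive : ∀ i → σ (σ i) ≡ i
  σ-involutive zero = refl
  σ-involutive (suc zero) = refl
  σ-other : ∀ i j → σ i ≢ j ⇔ i ≡ j
  σ-other zero zero = mk⇔ (λ _ → refl) (λ _ ())
  σ-other zero (suc zero) = mk⇔ (λ σi≢j → ⊥-elim (σi≢j refl)) (λ ())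
  σ-other (suc zero) zero = mk⇔ (λ σi≢j → ⊥-elim (σi≢j refl)) (λ ())
  σ-other (suc zero) (suc zero) = mk⇔ (λ _ → refl) (λ _ ())

module SpiderFacts {V : Set} {H : Graph V} {q : V → Part} {t : SpiderType} (sp : Spider H q t) where
  open Spider sp
  open PseudoSplit pseudoSplit

  c-adjacent : ∀ {i j} → i ≢ j → E H (c i) (c j)
  c-adjacent {i} {j} i≢j = C-clique (c i) (c j) (c-in-C i) (c-in-C j) (i≢j ∘ c-inj)

  s-nonadjacent : ∀ i j → ¬ E H (s i) (s j)
  s-nonadjacent i j = S-indep (s i) (s j) (s-in-S i) (s-in-S j)

  vertex-view : ∀ v → q v ≢ R → (∃ λ i → c i ≡ v) ⊎ (∃ λ i → s i ≡ v)
  vertex-view v v∉R with q v in qv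
  ... | R = ⊥-elim (v∉R refl)
  ... | C = inj₁ (C-onto v qv)
  ... | S = inj₂ (S-onto v qv)

thick⇒thin : ∀ {V} {H : Graph V} {q} (sp : Spider H q thick) → Spider.k sp ≤ 2 → Spider H q thin
thick⇒thin sp k≤2 with swap-of-two (Spider.2≤k sp) k≤2
... | σ , σ-involutive , σ-other = record
  { pseudoSplit = pseudoSplit
  ; k = k
  ; 2≤k = 2≤k
  ; c = c
  ; s = s ∘ σ
  ; c-inj = c-inj
  ; s-inj = λ {i} {j} e → trans (sym (σ-involutive i)) (trans (cong σ (s-inj e)) (σ-involutive j))
  ; c-in-C = c-in-C
  ; s-in-S = s-in-S ∘ σ
  ; C-onto = C-onto
  ; S-onto = λ v qv → let (i , si≡v) = S-onto v qv in σ i , trans (cong s (σ-involutive i)) si≡v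
  ; legs = λ i j → ⇔-trans (legs (σ i) j) (σ-other i j)
  }
  where open Spider sp

module ThinLegs {n k : ℕ} (G : Graph (Fin n)) (c s : Fin k → Fin n)
  (c-adjacent : ∀ {i j} → i ≢ j → E G (c i) (c j))
  (s-nonadjacent : ∀ i j → ¬ E G (s i) (s j))
  (legs : ∀ i j → E G (s i) (c j) ⇔ i ≡ j) where

  open IndependentSets G

  leg : ∀ i → E G (s i) (c i)
  leg i = Equivalence.from (legs i i) refl

  c≢s : ∀ i j → c i ≢ s j
  c≢s i j ci≡sj = s-nonadjacent i j (subst (E G (s i)) ci≡sj (leg i))

  c∉S : ∀ j → c j ∉ image s
  c∉S j cj∈S with ∈-image⁻ s cj∈S
  ... | i , si≡cj = c≢s j i (sym si≡cj)

  S-independent : Independent G (image s)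
  S-independent u v u∈S v∈S with ∈-image⁻ s u∈S | ∈-image⁻ s v∈S
  ... | i , refl | j , refl = s-nonadjacent i j

  InSpider : Subset n → Set
  InSpider I = ∀ u → u ∈ I → (∃ λ i → c i ≡ u) ⊎ (∃ λ i → s i ≡ u)

  module _ {I : Subset n} (maxI : MaximalIndependent G I) (I-in-spider : InSpider I) where

    leg-in-maximal : ∀ l → (∀ m → c m ∈ I → m ≢ l) → s l ∈ I
    leg-in-maximal l no-cl = maximal⇒dominating maxI (s l) free
      where
      free : ∀ u → u ∈ I → ¬ E G u (s l)
      free u u∈I u~sl with I-in-spider u u∈I
      ... | inj₁ (m , refl) = no-cl m u∈I (sym (Equivalence.to (legs l m) (E-sym u~sl)))
      ... | inj₂ (m , refl) = s-nonadjacent m l u~sl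

    c-unique : ∀ {i j} → c i ∈ I → c j ∈ I → i ≡ j
    c-unique {i} {j} ci∈I cj∈I with i ≟ j
    ... | yes i≡j = i≡j
    ... | no i≢j = ⊥-elim (proj₁ maxI (c i) (c j) ci∈I cj∈I (c-adjacent i≢j))

    maximal-without-C : (∀ j → c j ∉ I) → I ≡ image s
    maximal-without-C no-c = ⊆-antisym I⊆S S⊆I
      where
      I⊆S : I ⊆ image s
      I⊆S {u} u∈I with I-in-spider u u∈I
      ... | inj₁ (i , refl) = ⊥-elim (no-c i u∈I)
      ... | inj₂ (i , refl) = ∈-image⁺ s i
      S⊆I : image s ⊆ I
      S⊆I u∈S with ∈-image⁻ s u∈S
      ... | l , refl = leg-in-maximal l λ m cm∈I _ → no-c m cm∈I

    maximal-with-C : ∀ {j} → c j ∈ I → I ≡ (image s - s j) ∪ ⁅ c j ⁆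
    maximal-with-C {j} cj∈I = ⊆-antisym I⊆J J⊆I
      where
      I⊆J : I ⊆ (image s - s j) ∪ ⁅ c j ⁆
      I⊆J {u} u∈I with I-in-spider u u∈I
      ... | inj₁ (i , refl) rewrite c-unique u∈I cj∈I = q⊆p∪q _ ⁅ c j ⁆ (x∈⁅x⁆ (c j))
      ... | inj₂ (i , refl) = p⊆p∪q ⁅ c j ⁆ (x∈p∧x≢y⇒x∈p-y (∈-image⁺ s i) λ si≡sj →
            proj₁ maxI (s i) (c j) u∈I cj∈I (subst (λ v → E G v (c j)) (sym si≡sj) (leg j)))
      J⊆I : (image s - s j) ∪ ⁅ c j ⁆ ⊆ I
      J⊆I u∈J with x∈p∪q⁻ (image s - s j) ⁅ c j ⁆ u∈J
      ... | inj₂ u∈cj rewrite x∈⁅y⁆⇒x≡y (c j) u∈cj = cj∈I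
      ... | inj₁ u∈S-sj with ∈-image⁻ s (p─q⊆p (image s) ⁅ s j ⁆ u∈S-sj)
      ...   | l , refl = leg-in-maximal l λ m cm∈I m≡l →
              x∈p-y⇒x≢y u∈S-sj (cong s (trans (sym m≡l) (c-unique cm∈I cj∈I)))

    maximal-size : ∣ I ∣ ≡ ∣ image s ∣
    maximal-size with any? (λ j → c j ∈? I)
    ... | no no-c = cong ∣_∣ (maximal-without-C λ j cj∈I → no-c (j , cj∈I))
    ... | yes (j , cj∈I) = begin
      ∣ I ∣                            ≡⟨ cong ∣_∣ (maximal-with-C cj∈I) ⟩
      ∣ (image s - s j) ∪ ⁅ c j ⁆ ∣    ≡⟨ ∣p∪⁅x⁆∣≡1+∣p∣ (c∉S j ∘ p─q⊆p (image s) ⁅ s j ⁆) ⟩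
      suc ∣ image s - s j ∣            ≡⟨ ∣p∣≡1+∣p-x∣ (∈-image⁺ s j) ⟨
      ∣ image s ∣                      ∎
      where open ≡-Reasoning

thinSpider⇒wellCovered : ∀ {n} {G : Graph (Fin n)} {p} → R-empty p → Spider G p thin → WellCovered G
thinSpider⇒wellCovered {G = G} no-R sp I J maxI maxJ = trans (size maxI) (sym (size maxJ))
  where
  open SpiderFacts sp
  open ThinLegs G (Spider.c sp) (Spider.s sp) c-adjacent s-nonadjacent (Spider.legs sp)
  size : ∀ {I} → MaximalIndependent G I → ∣ I ∣ ≡ ∣ image (Spider.s sp) ∣
  size maxI = maximal-size maxI λ u _ → vertex-view u (no-R u)

-- Adjacency to b is adjacency to its twin a, so the spider structure of G － b holds in G
-- except possibly on the pair {a , b}.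
module SubstitutedSpider {n : ℕ} {G : Graph (Fin n)} {p : Fin n → Part} {t : SpiderType}
  {a b : Fin n}
  (sp : SubstPair G p a b) (SP : Spider (G － b) (restrict p) t) where

  open IndependentSets G
  open SubstPair sp
  open PseudoSplit (Spider.pseudoSplit SP)
  open SpiderFacts SP public using (c-adjacent; s-nonadjacent)
  open SpiderFacts SP using (vertex-view)
  open Spider SP public using (k; 2≤k; c-in-C; s-in-S)

  c s : Fin k → Fin n
  c i = proj₁ (Spider.c SP i)
  s i = proj₁ (Spider.s SP i)

  c≢b : ∀ i → c i ≢ b
  c≢b i = proj₂ (Spider.c SP i)

  s≢b : ∀ i → s i ≢ b
  s≢b i = proj₂ (Spider.s SP i)

  ⟨_⟩ : ∀ {u} → u ≢ b → Σ (Fin n) λ v → v ≢ b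
  ⟨_⟩ {u} u≢b = u , u≢b

  twin→ : ∀ {v} → v ≢ a → v ≢ b → E G a v → E G b v
  twin→ v≢a v≢b = Equivalence.to (twins _ v≢a v≢b)

  twin← : ∀ {v} → v ≢ a → v ≢ b → E G b v → E G a v
  twin← v≢a v≢b = Equivalence.from (twins _ v≢a v≢b)

  part-≢ : ∀ {X Y u} → p u ≡ X → X ≢ Y → p u ≢ Y
  part-≢ pu X≢Y pu≡Y = X≢Y (trans (sym pu) pu≡Y)

  ≢-by-part : ∀ {X Y u v} → p u ≡ X → p v ≡ Y → X ≢ Y → u ≢ v
  ≢-by-part pu pv X≢Y refl = X≢Y (trans (sym pu) pv)

  Twins : Fin n → Fin n → Set
  Twins u v = (u ≡ a × v ≡ b) ⊎ (u ≡ b × v ≡ a)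

  twins-sym : ∀ {u v} → Twins u v → Twins v u
  twins-sym (inj₁ (u≡a , v≡b)) = inj₂ (v≡b , u≡a)
  twins-sym (inj₂ (u≡b , v≡a)) = inj₁ (v≡a , u≡b)

  twins-share : ∀ {u v w} → Twins u v → w ≢ a → w ≢ b → E G u w → E G v w
  twins-share (inj₁ (refl , refl)) = twin→
  twins-share (inj₂ (refl , refl)) = twin←

  R≢a : ∀ {r} → p r ≡ R → r ≢ a
  R≢a pr refl = notR pr

  R≢b : ∀ {r} → p r ≡ R → r ≢ b
  R≢b pr refl = notR (trans samePart pr)

  R-C-adjacent : ∀ {r w} → p r ≡ R → p w ≡ C → E G r w
  R-C-adjacent {w = w} pr pw with w ≟ b
  ... | no w≢b = R-C-full ⟨ R≢b pr ⟩ ⟨ w≢b ⟩ pr pw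
  ... | yes refl = E-sym (twin→ (R≢a pr) (R≢b pr)
                     (E-sym (R-C-full ⟨ R≢b pr ⟩ ⟨ a≢b ⟩ pr (trans samePart pw))))

  R-S-nonadjacent : ∀ {r v} → p r ≡ R → p v ≡ S → ¬ E G r v
  R-S-nonadjacent {v = v} pr pv rv with v ≟ b
  ... | no v≢b = R-S-empty ⟨ R≢b pr ⟩ ⟨ v≢b ⟩ pr pv rv
  ... | yes refl = R-S-empty ⟨ R≢b pr ⟩ ⟨ a≢b ⟩ pr (trans samePart pv)
                     (E-sym (twin← (R≢a pr) (R≢b pr) (E-sym rv)))

  C-non-neighbour-of-b : ∀ {v} → p b ≡ C → p v ≡ C → v ≢ b → ¬ E G b v → v ≡ a
  C-non-neighbour-of-b {v} pb pv v≢b ¬bv with v ≟ a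
  ... | yes v≡a = v≡a
  ... | no v≢a = ⊥-elim (¬bv (twin→ v≢a v≢b
                   (C-clique ⟨ a≢b ⟩ ⟨ v≢b ⟩ (trans samePart pb) pv (v≢a ∘ sym ∘ cong proj₁))))

  C-nonadjacent⇒twins : ∀ {u v} → p u ≡ C → p v ≡ C → u ≢ v → ¬ E G u v → Twins u v
  C-nonadjacent⇒twins {u} {v} pu pv u≢v ¬uv with u ≟ b | v ≟ b
  ... | yes refl | yes refl = ⊥-elim (u≢v refl)
  ... | yes refl | no v≢b = inj₂ (refl , C-non-neighbour-of-b pu pv v≢b ¬uv)
  ... | no u≢b | yes refl = inj₁ (C-non-neighbour-of-b pv pu u≢b (¬uv ∘ E-sym) , refl)
  ... | no u≢b | no v≢b = ⊥-elim (¬uv (C-clique ⟨ u≢b ⟩ ⟨ v≢b ⟩ pu pv (u≢v ∘ cong proj₁)))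

  S-neighbour-of-b : ∀ {v} → p b ≡ S → p v ≡ S → v ≢ b → E G b v → v ≡ a
  S-neighbour-of-b {v} pb pv v≢b bv with v ≟ a
  ... | yes v≡a = v≡a
  ... | no v≢a = ⊥-elim (S-indep ⟨ a≢b ⟩ ⟨ v≢b ⟩ (trans samePart pb) pv (twin← v≢a v≢b bv))

  S-adjacent⇒twins : ∀ {u v} → p u ≡ S → p v ≡ S → E G u v → Twins u v
  S-adjacent⇒twins {u} {v} pu pv uv with u ≟ b | v ≟ b
  ... | yes refl | yes refl = ⊥-elim (E-irrefl uv)
  ... | yes refl | no v≢b = inj₂ (refl , S-neighbour-of-b pu pv v≢b uv)
  ... | no u≢b | yes refl = inj₁ (S-neighbour-of-b pv pu u≢b (E-sym uv) , refl)
  ... | no u≢b | no v≢b = ⊥-elim (S-indep ⟨ u≢b ⟩ ⟨ v≢b ⟩ pu pv uv)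

  non-neighbour-of-C : ∀ {u w} → p w ≡ C → w ≢ a → w ≢ b → u ≢ w → ¬ E G u w → p u ≡ S
  non-neighbour-of-C {u} pw w≢a w≢b u≢w ¬uw with p u in pu
  ... | R = ⊥-elim (¬uw (R-C-adjacent pu pw))
  ... | C = ⊥-elim ([ w≢b ∘ proj₂ , w≢a ∘ proj₂ ] (C-nonadjacent⇒twins pu pw u≢w ¬uw))
  ... | S = refl

  nonadjacent-via-C : ∀ {u v w} → p u ≡ S → ¬ E G u w → E G w v → p v ≢ C → w ≢ a → w ≢ b →
                      ¬ E G u v
  nonadjacent-via-C {v = v} pu ¬uw wv v∉C w≢a w≢b with p v in pv
  ... | R = λ uv → R-S-nonadjacent pv pu (E-sym uv)
  ... | C = ⊥-elim (v∉C refl)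
  ... | S = λ uv → ¬uw (twins-share (twins-sym (S-adjacent⇒twins pu pv uv)) w≢a w≢b (E-sym wv))

  no-exchange-at-C : WellCovered G → ∀ {w y z} → p w ≡ C → w ≢ a → w ≢ b →
    E G w y → E G w z → p y ≢ C → p z ≢ C → y ≢ z → ¬ E G y z → ⊥
  no-exchange-at-C wc {w} {y} {z} pw w≢a w≢b wy wz y∉C z∉C y≢z ¬yz with extend (⁅⁆-independent w)
  ... | I , maxI , w⊆I = no-1-for-2-exchange wc maxI w∈I wy wz y≢z ¬yz free
    where
    w∈I : w ∈ I
    w∈I = w⊆I (x∈⁅x⁆ w)
    free : ∀ u → u ∈ I → u ≢ w → ¬ E G u y × ¬ E G u z
    free u u∈I u≢w =
      nonadjacent-via-C pu ¬uw wy y∉C w≢a w≢b , nonadjacent-via-C pu ¬uw wz z∉C w≢a w≢b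
      where
      ¬uw : ¬ E G u w
      ¬uw = proj₁ maxI u w u∈I w∈I
      pu : p u ≡ S
      pu = non-neighbour-of-C pw w≢a w≢b u≢w ¬uw

  vertex-view′ : ∀ {u} → u ≢ b → p u ≢ R → (∃ λ i → c i ≡ u) ⊎ (∃ λ i → s i ≡ u)
  vertex-view′ u≢b u∉R = Sum.map (map₂ (cong proj₁)) (map₂ (cong proj₁)) (vertex-view ⟨ u≢b ⟩ u∉R)

  c-injective : ∀ {i j} → c i ≡ c j → i ≡ j
  c-injective {i} {j} ci≡cj with i ≟ j
  ... | yes i≡j = i≡j
  ... | no i≢j = ⊥-elim (E-irrefl (subst (E G (c i)) (sym ci≡cj) (c-adjacent i≢j)))

  wellCovered⇒R-empty : WellCovered G → R-empty p
  wellCovered⇒R-empty wc r pr with avoiding 2≤k c-injective a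
  ... | j , cj≢a with C-has-S-nbr (Spider.c SP j) (c-in-C j)
  ...   | (v , v≢b) , pv , cj~v =
    no-exchange-at-C wc (c-in-C j) cj≢a (c≢b j) (E-sym (R-C-adjacent pr (c-in-C j))) cj~v
      (part-≢ pr λ ()) (part-≢ pv λ ()) (≢-by-part pr pv λ ()) (R-S-nonadjacent pr pv)

module _ {n : ℕ} {G : Graph (Fin n)} {p : Fin n → Part} {a b : Fin n}
  (sp : SubstPair G p a b) (SP : Spider (G － b) (restrict p) thick) where

  open IndependentSets G
  open SubstitutedSpider sp SP

  wellCovered⇒thick-k≤2 : WellCovered G → k ≤ 2
  wellCovered⇒thick-k≤2 wc with k ≤? 2
  ... | yes k≤2 = k≤2
  ... | no k≰2 with avoiding 2≤k c-injective a
  ...   | j , cj≢a with two-other-indices (≰⇒> k≰2) j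
  ...     | x , y , x≢j , y≢j , x≢y =
    ⊥-elim (no-exchange-at-C wc (c-in-C j) cj≢a (c≢b j) (leg x≢j) (leg y≢j)
             (part-≢ (s-in-S x) λ ()) (part-≢ (s-in-S y) λ ()) sx≢sy (s-nonadjacent x y))
    where
    leg : ∀ {l} → l ≢ j → E G (c j) (s l)
    leg {l} l≢j = E-sym (Equivalence.from (Spider.legs SP l j) l≢j)
    sx≢sy : s x ≢ s y
    sx≢sy sx≡sy = Equivalence.to (Spider.legs SP y y)
      (subst (λ v → E G v (c y)) sx≡sy (Equivalence.from (Spider.legs SP x y) x≢y)) refl

module ThinSubstitution {n : ℕ} {G : Graph (Fin n)} {p : Fin n → Part} {a b : Fin n}
  (sp : SubstPair G p a b) (SP : Spider (G － b) (restrict p) thin) where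

  open IndependentSets G
  open SubstPair sp
  open SubstitutedSpider sp SP
  open ThinLegs G c s c-adjacent s-nonadjacent (Spider.legs SP) public

  position-of-a : (∃ λ i → c i ≡ a) ⊎ (∃ λ i → s i ≡ a)
  position-of-a = vertex-view′ a≢b notR

  module _ {i₀} (ci₀≡a : c i₀ ≡ a) where

    leg-of-a≢a : s i₀ ≢ a
    leg-of-a≢a si₀≡a = c≢s i₀ i₀ (trans ci₀≡a (sym si₀≡a))

    leg-of-a~a : E G (s i₀) a
    leg-of-a~a = subst (E G (s i₀)) ci₀≡a (leg i₀)

    leg-of-a~b : E G (s i₀) b
    leg-of-a~b = E-sym (twin→ leg-of-a≢a (s≢b i₀) (E-sym leg-of-a~a))

  S-maximal : R-empty p → ∀ {i₀} → c i₀ ≡ a → MaximalIndependent G (image s)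
  S-maximal no-R {i₀} ci₀≡a = dominating⇒maximal S-independent dominating
    where
    dominating : Dominating (image s)
    dominating v free with v ≟ b
    ... | yes refl = ⊥-elim (free (s i₀) (∈-image⁺ s i₀) (leg-of-a~b ci₀≡a))
    ... | no v≢b with vertex-view′ v≢b (no-R v)
    ...   | inj₁ (l , refl) = ⊥-elim (free (s l) (∈-image⁺ s l) (leg l))
    ...   | inj₂ (l , refl) = ∈-image⁺ s l

  no-C-false-twins : WellCovered G → R-empty p → p a ≡ C → ¬ E G a b → ⊥
  no-C-false-twins wc no-R pa ¬ab with position-of-a
  ... | inj₂ (_ , si≡a) = ≢-by-part (s-in-S _) pa (λ ()) si≡a
  ... | inj₁ (i₀ , ci₀≡a) =
    no-1-for-2-exchange wc (S-maximal no-R ci₀≡a) (∈-image⁺ s i₀)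
      (leg-of-a~a ci₀≡a) (leg-of-a~b ci₀≡a) a≢b ¬ab free
    where
    free : ∀ u → u ∈ image s → u ≢ s i₀ → ¬ E G u a × ¬ E G u b
    free u u∈S u≢si₀ with ∈-image⁻ s u∈S
    ... | l , refl = ¬sl~a , ¬sl~a ∘ E-sym ∘ twin← sl≢a (s≢b l) ∘ E-sym
      where
      ¬sl~a : ¬ E G (s l) a
      ¬sl~a sl~a =
        u≢si₀ (cong s (Equivalence.to (Spider.legs SP l i₀) (subst (E G (s l)) (sym ci₀≡a) sl~a)))
      sl≢a : s l ≢ a
      sl≢a = ≢-by-part (s-in-S l) pa λ ()

  no-S-false-twins : WellCovered G → p a ≡ S → ¬ E G a b → ⊥
  no-S-false-twins wc pa ¬ab with position-of-a
  ... | inj₁ (_ , ci≡a) = ≢-by-part (c-in-C _) pa (λ ()) ci≡a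
  ... | inj₂ (i₀ , si₀≡a) =
    no-exchange-at-C wc (c-in-C i₀) ci₀≢a (c≢b i₀) ci₀~a ci₀~b
      (part-≢ pa λ ()) (part-≢ (trans (sym samePart) pa) λ ()) a≢b ¬ab
    where
    ci₀≢a : c i₀ ≢ a
    ci₀≢a = ≢-by-part (c-in-C i₀) pa λ ()
    ci₀~a : E G (c i₀) a
    ci₀~a = E-sym (subst (λ v → E G v (c i₀)) si₀≡a (leg i₀))
    ci₀~b : E G (c i₀) b
    ci₀~b = E-sym (twin→ ci₀≢a (c≢b i₀) (E-sym ci₀~a))

  wellCovered⇒twins-adjacent : WellCovered G → R-empty p → E G a b
  wellCovered⇒twins-adjacent wc no-R with E? a b
  ... | yes ab = ab
  ... | no ¬ab with p a in pa
  ...   | R = ⊥-elim (notR pa)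
  ...   | C = ⊥-elim (no-C-false-twins wc no-R pa ¬ab)
  ...   | S = ⊥-elim (no-S-false-twins wc pa ¬ab)

open ThinSubstitution using (wellCovered⇒twins-adjacent)

thinSpiderK2⇒wellCovered : ∀ {n} {G : Graph (Fin n)} {p} → R-empty p → ThinSpiderK2 G p →
                           WellCovered G
thinSpiderK2⇒wellCovered {G = G} no-R (a , b , sp , ab , SP) I J maxI maxJ =
  trans (size maxI) (sym (size maxJ))
  where
  open IndependentSets G
  open ThinSubstitution sp SP
  open SubstitutedSpider sp SP using (s; vertex-view′)
  size : ∀ {I} → MaximalIndependent G I → ∣ I ∣ ≡ ∣ image s ∣
  size maxI with maximal-avoiding-twin ab (SubstPair.twins sp) maxI
  ... | I′ , maxI′ , ∣I′∣≡∣I∣ , b∉I′ =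
    trans (sym ∣I′∣≡∣I∣)
      (maximal-size maxI′ λ u u∈I′ → vertex-view′ (λ { refl → b∉I′ u∈I′ }) (no-R u))

wellCovered⇒thinSpiderK2 : ∀ {n} {G : Graph (Fin n)} {p} → QuasiSpider G p → WellCovered G →
                           R-empty p × ThinSpiderK2 G p
wellCovered⇒thinSpiderK2 {G = G} {p} (_ , a , b , sp , SP) wc =
  no-R , a , b , sp , wellCovered⇒twins-adjacent sp (as-thin SP) wc no-R , as-thin SP
  where
  no-R : R-empty p
  no-R = SubstitutedSpider.wellCovered⇒R-empty sp SP wc
  as-thin : ∀ {t} → Spider (G － b) (restrict p) t → Spider (G － b) (restrict p) thin
  as-thin {thin} SP = SP
  as-thin {thick} SP = thick⇒thin SP (wellCovered⇒thick-k≤2 sp SP wc)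

lemma18 : {n : ℕ} (G : Graph (Fin n)) (p : Fin n → Part) → QuasiSpider G p →
    (WellCovered G ⇔ (R-empty p × (Spider G p thin ⊎ ThinSpiderK2 G p)))
lemma18 G p qs = mk⇔ (map₂ inj₂ ∘ wellCovered⇒thinSpiderK2 qs) λ where
  (no-R , inj₁ spider)   → thinSpider⇒wellCovered no-R spider
  (no-R , inj₂ spiderK2) → thinSpiderK2⇒wellCovered no-R spiderK2
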